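{- Let $A,B:V\times V\to C$ be two square matrices indexed by a finite set $V$ with entries in a (not necessarily commutative) ring $C$. If $r\ge1$ and $(i,j),(p,q)\in V^2$ satisfy $X^r_{A,2}(i,j)=X^r_{B,2}(p,q)$, then $(A^r)(i,j)=(B^r)(p,q)$.
   Context: For $A:V\times V\to C$, the atomic type $\mathrm{tp}_A(i_1,\dots,i_k)$ of a $k$-tuple is the $k\times k$ array $T$ with $T_{a,b}=(0,A(i_a,i_b))$ if $i_a=i_b$ and $(1,A(i_a,i_b))$ if $i_a\ne i_b$. The $2$-WL colorings are $X^1_{A,2}=\mathrm{tp}_A$ (on pairs) and $X^{r+1}_{A,2}(i,j)=\big(X^r_{A,2}(i,j),\{\!\{(\mathrm{tp}_A(i,j,m),X^r_{A,2}(i,m),X^r_{A,2}(m,j)):m\in V\}\!\}\big)$, where $\{\!\{\cdot\}\!\}$ denotes a multiset. Colors are abstract objects built this way, so colors of $A$ and $B$ can be compared. -}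

module Defs where

open import Level using (Level)
open import Algebra.Bundles using (Ring)
open import Data.Nat using (ℕ; zero; suc)
open import Data.Fin using (Fin; _≟_)
open import Data.Bool using (Bool; if_then_else_; not)
open import Data.Product using (Σ; _×_; _,_; proj₁; proj₂)
open import Data.Unit.Polymorphic using (⊤)
open import Data.Vec.Functional using (Vector; []; _∷_)
open import Function.Bundles using (_↔_; Inverse)
open import Relation.Nullary.Decidable using (⌊_⌋)
open import Relation.Binary.PropositionalEquality using (_≡_)

module WL {c ℓ : Level} (C : Ring c ℓ) where
  open Ring C
  open import Algebra.Properties.Monoid.Sum +-monoid using (sum)

  Matrix : ℕ → Set c
  Matrix n = Fin n → Fin n → Carrier

  infixl 7 _⊗_
  _⊗_ : ∀ {n} → Matrix n → Matrix n → Matrix n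
  (M ⊗ N) i j = sum (λ k → M i k * N k j)

  I : ∀ {n} → Matrix n
  I i j = if ⌊ i ≟ j ⌋ then 1# else 0#

  infixr 8 _^_
  _^_ : ∀ {n} → Matrix n → ℕ → Matrix n
  A ^ zero    = I
  A ^ suc r   = (A ^ r) ⊗ A

  -- Atomic type of a k-tuple (given as a function Fin k → V):
  -- entry (a,b) is (false, A(i_a,i_b)) if i_a = i_b  ("0")
  --           and  (true , A(i_a,i_b)) if i_a ≠ i_b  ("1").
  tp : ∀ {n k} → Matrix n → (Fin k → Fin n) → Fin k → Fin k → Bool × Carrier
  tp A is a b = (not ⌊ is a ≟ is b ⌋ , A (is a) (is b))

  TpEq : ∀ {k} → (Fin k → Fin k → Bool × Carrier) → (Fin k → Fin k → Bool × Carrier) → Set ℓ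
  TpEq {k = k} S T = ∀ (a b : Fin k) →
    (Data.Product.Σ (proj₁ (S a b) ≡ proj₁ (T a b)) λ _ → proj₂ (S a b) ≈ proj₂ (T a b))

  -- SameColor r A i j B p q  expresses  X^r_{A,2}(i,j) = X^r_{B,2}(p,q)  for r ≥ 1.
  -- (The r = 0 case is unused; it is set to ⊤.)
  -- Equality of the multisets {{ … : m ∈ V }} is the existence of a bijection
  -- π : V ↔ V matching the element for m with the element for π m.
  SameColor : ∀ {n} → ℕ → Matrix n → Fin n → Fin n → Matrix n → Fin n → Fin n → Set ℓ
  SameColor zero _ _ _ _ _ _ = ⊤ {ℓ}
  SameColor (suc zero) A i j B p q = TpEq {k = 2} (tp A (i ∷ j ∷ [])) (tp B (p ∷ q ∷ []))
  SameColor {n} (suc (suc r)) A i j B p q =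
    SameColor (suc r) A i j B p q ×
    Σ (Fin n ↔ Fin n) λ π → ∀ (m : Fin n) →
      TpEq {k = 3} (tp A (i ∷ j ∷ m ∷ [])) (tp B (p ∷ q ∷ Inverse.to π m ∷ [])) ×
      SameColor (suc r) A i m B p (Inverse.to π m) ×
      SameColor (suc r) A m j B (Inverse.to π m) q

module Submission where

open import Defs
open import Level using (Level)
open import Algebra.Bundles using (Ring)
open import Data.Nat using (ℕ; _≤_; zero; suc; s≤s)
open import Data.Fin using (Fin; zero; suc; _≟_; punchIn)
open import Data.Fin.Properties using (punchInᵢ≢i)
open import Data.Product using (_,_; proj₂)
open import Function.Bundles using (Inverse)
open import Relation.Nullary using (yes; no; contradiction)
open import Relation.Binary.PropositionalEquality using (_≢_) renaming (refl to ≡-refl)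

-- Induction on r.  (A^{r+1})(i,j) = Σ_m (A^r)(i,m)·A(m,j), and the colour
-- X^{r+1}(i,j) records the multiset over m of (tp(i,j,m), X^r(i,m), X^r(m,j)).
-- A bijection π matching the multisets of (i,j) and (p,q) therefore matches the
-- summand at m with the summand at π m: A(m,j) = B(π m,q) is an entry of the
-- atomic types, and (A^r)(i,m) = (B^r)(p,π m) holds by induction.  Sums over a
-- finite set are invariant under permutation.

module MatrixPowerColour {c ℓ : Level} (C : Ring c ℓ) where
  open Ring C hiding (zero)
  open WL C
  open import Algebra.Properties.Monoid.Sum +-monoid using (sum; sum-cong-≋; sum-replicate-zero)
  open import Algebra.Properties.CommutativeMonoid.Sum +-commutativeMonoid using (sum-remove; sum-permute)
  open import Relation.Binary.Reasoning.Setoid setoid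

  sum-zero : ∀ {n} (f : Fin n → Carrier) → (∀ k → f k ≈ 0#) → sum f ≈ 0#
  sum-zero {n} f f≈0 = trans (sum-cong-≋ f≈0) (sum-replicate-zero n)

  sum-supported-at : ∀ {n} (f : Fin n → Carrier) (i : Fin n) →
                     (∀ k → k ≢ i → f k ≈ 0#) → sum f ≈ f i
  sum-supported-at {suc n} f i vanish = begin
    sum f                             ≈⟨ sum-remove f ⟩
    f i + sum (λ k → f (punchIn i k)) ≈⟨ +-congˡ (sum-zero _ (λ k → vanish _ (punchInᵢ≢i i k))) ⟩
    f i + 0#                          ≈⟨ +-identityʳ (f i) ⟩
    f i                               ∎

  I-diagonal : ∀ {n} (i : Fin n) → I i i ≈ 1#
  I-diagonal i with i ≟ i
  ... | yes _  = refl
  ... | no i≢i = contradiction ≡-refl i≢i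

  I-off-diagonal : ∀ {n} {i k : Fin n} → k ≢ i → I i k ≈ 0#
  I-off-diagonal {i = i} {k} k≢i with i ≟ k
  ... | yes ≡-refl = contradiction ≡-refl k≢i
  ... | no _       = refl

  I-⊗ : ∀ {n} (M : Matrix n) i j → (I ⊗ M) i j ≈ M i j
  I-⊗ M i j = begin
    sum (λ k → I i k * M k j) ≈⟨ sum-supported-at _ i (λ k k≢i → trans (*-congʳ (I-off-diagonal k≢i)) (zeroˡ (M k j))) ⟩
    I i i * M i j             ≈⟨ *-congʳ (I-diagonal i) ⟩
    1# * M i j                ≈⟨ *-identityˡ (M i j) ⟩
    M i j                     ∎

  ^-one : ∀ {n} (A : Matrix n) i j → (A ^ 1) i j ≈ A i j
  ^-one = I-⊗

  sameColor⇒^-≈ : ∀ {n} (A B : Matrix n) r (i j p q : Fin n) →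
                  SameColor (suc r) A i j B p q → (A ^ suc r) i j ≈ (B ^ suc r) p q
  sameColor⇒^-≈ A B zero i j p q same = begin
    (A ^ 1) i j ≈⟨ ^-one A i j ⟩
    A i j       ≈⟨ proj₂ (same zero (suc zero)) ⟩
    B p q       ≈⟨ sym (^-one B p q) ⟩
    (B ^ 1) p q ∎
  sameColor⇒^-≈ {n} A B (suc r) i j p q (_ , π , matched) = begin
    sum (λ m → (A ^ suc r) i m * A m j)           ≈⟨ sum-cong-≋ summand-≈ ⟩
    sum (λ m → (B ^ suc r) p (π→ m) * B (π→ m) q) ≈⟨ sym (sum-permute (λ m → (B ^ suc r) p m * B m q) π) ⟩
    sum (λ m → (B ^ suc r) p m * B m q)           ∎
    where
    π→ : Fin n → Fin n
    π→ = Inverse.to π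
    summand-≈ : ∀ m → (A ^ suc r) i m * A m j ≈ (B ^ suc r) p (π→ m) * B (π→ m) q
    summand-≈ m with matched m
    ... | type≈ , left≈ , _ =
      -- entry (2,1) of the atomic type of (i, j, m) is A(m, j)
      *-cong (sameColor⇒^-≈ A B r i m p (π→ m) left≈) (proj₂ (type≈ (suc (suc zero)) (suc zero)))

theorem3p3 : ∀ {c ℓ : Level} (C : Ring c ℓ) (n : ℕ) (A B : WL.Matrix C n) (r : ℕ) →
    1 ≤ r → (i j p q : Fin n) →
    WL.SameColor C r A i j B p q →
    Ring._≈_ C (WL._^_ C A r i j) (WL._^_ C B r p q)
theorem3p3 C n A B (suc r) (s≤s _) = MatrixPowerColour.sameColor⇒^-≈ C A B r
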